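{- The coefficient of $q^N$ in $H_{4,3,4}(q)$ is nonnegative for every integer $N \ge 1042$.
   Context: $(a;q)_n := (1-a)(1-aq)\cdots(1-aq^{n-1})$. For positive integers $L,s,k$, $H_{L,s,k}(q) := \frac{q^s(1-q^k)}{(q^s;q)_{L+1}} - \left(\frac{1}{(q^{s+1};q)_L}-1\right)$. -}

module Defs where

open import Data.Nat using (ℕ; zero; suc; _+_; _∸_; _≟_)
open import Data.Integer using (ℤ; 0ℤ; 1ℤ; -_) renaming (_+_ to _+ℤ_; _*_ to _*ℤ_; _-_ to _-ℤ_)
open import Data.List using (List; []; _∷_)
open import Relation.Nullary using (yes; no)

Series : Set
Series = ℕ → ℤ

one : Series
one zero    = 1ℤ
one (suc _) = 0ℤ

mono : ℕ → Series
mono s n with n ≟ s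
... | yes _ = 1ℤ
... | no  _ = 0ℤ

_⊕_ : Series → Series → Series
(f ⊕ g) n = f n +ℤ g n

_⊖_ : Series → Series → Series
(f ⊖ g) n = f n -ℤ g n

convSum : Series → Series → ℕ → ℕ → ℤ
convSum f g n zero    = f 0 *ℤ g n
convSum f g n (suc k) = f (suc k) *ℤ g (n ∸ suc k) +ℤ convSum f g n k

_⊗_ : Series → Series → Series
(f ⊗ g) n = convSum f g n n

infixl 7 _⊗_
infixl 6 _⊕_ _⊖_

qPoch : ℕ → ℕ → Series
qPoch s zero    = one
qPoch s (suc n) = qPoch s n ⊗ (one ⊖ mono (s + n))

-- Multiplicative inverse of a power series f with constant term 1:
-- g_0 = 1,  g_n = - Σ_{k=1}^{n} f_k g_{n-k}.
-- invRev f n = [g_n , g_{n-1} , … , g_0].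
invStep : Series → ℕ → List ℤ → ℤ
invStep f i []       = 0ℤ
invStep f i (g ∷ gs) = f (suc i) *ℤ g +ℤ invStep f (suc i) gs

invRev : Series → ℕ → List ℤ
invRev f zero    = 1ℤ ∷ []
invRev f (suc n) = (- invStep f 0 (invRev f n)) ∷ invRev f n

inv : Series → Series
inv f n with invRev f n
... | []    = 0ℤ
... | g ∷ _ = g

H : ℕ → ℕ → ℕ → Series
H L s k = (mono s ⊗ (one ⊖ mono k)) ⊗ inv (qPoch s (suc L))
          ⊖ (inv (qPoch (suc s) L) ⊖ one)

{-# OPTIONS --safe #-}
-- Writing gₐ = 1/(1 − qᵃ), the factor 1 − q⁴ cancels and H₄,₃,₄ = 1 + F g₅ g₆ g₇ with F = q³g₃ − g₄.
-- Multiplying by gₐ turns coefficients yₙ into stride sums yₙ + yₙ₋ₐ + yₙ₋₂ₐ + ⋯, which can be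
-- evaluated directly. The coefficients of F are 12-periodic from index 1 on, so every 60 steps those
-- of F g₅ grow by a sum of twelve coefficients of F at stride 5; as 5 generates ℤ/12 this sum is one
-- full period, equal to 1. Hence a window of 60 nonnegative coefficients propagates upwards, and
-- F g₅ ≥ 0 from index 41 on. Stride sums of eventually nonnegative sequences are again eventually
-- nonnegative once a window of length a is, giving F g₅ g₆ ≥ 0 from 71 and F g₅ g₆ g₇ ≥ 0 from 64 on.
module Submission where

open import Algebra.Bundles using (CommutativeMonoid)
import Algebra.Properties.CommutativeSemigroup as CommutativeSemigroupProperties
open import Data.Fin using (Fin; toℕ; fromℕ<)
open import Data.Fin.Properties using (toℕ-fromℕ<; all?)
open import Data.Integer using (ℤ; 0ℤ; 1ℤ; -_; _+_; _*_; _-_) renaming (_≤_ to _≤ℤ_)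
open import Data.Integer.Properties using (+-comm; +-assoc; *-zeroˡ; *-identityˡ; +-identityˡ; +-identityʳ; *-comm; *-assoc)
import Data.Integer.Properties as ℤ
open import Data.Integer.Tactic.RingSolver using (solve-∀)
open import Data.List using (List; []; _∷_)
open import Data.Nat using (ℕ; zero; suc; _∸_; _≟_; _≤_; _<_; _<?_; z≤n; s≤s; z<s) renaming (_+_ to _+ℕ_; _*_ to _*ℕ_)
open import Data.Nat.Induction using (<-rec)
import Data.Nat.Properties as ℕ
open import Data.Product using (_,_)
open import Function using (const; _∘_)
open import Induction.WellFounded using (WfRec)
open import Relation.Binary.Bundles using (Setoid)
open import Relation.Binary.PropositionalEquality
import Relation.Binary.Reasoning.Setoid as SetoidReasoning
open import Relation.Nullary using (Dec; yes; no; contradiction)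
open import Relation.Nullary.Decidable using (from-yes)

open import Defs

module ℕ+ = CommutativeSemigroupProperties ℕ.+-commutativeSemigroup
module ℤ+ = CommutativeSemigroupProperties ℤ.+-commutativeSemigroup

tail : Series → Series
tail f n = f (suc n)

_·_ : ℤ → Series → Series
(a · f) n = a * f n

infixr 8 _·_

convSum-cong : ∀ {f f′ g g′} → f ≗ f′ → g ≗ g′ → ∀ n k → convSum f g n k ≡ convSum f′ g′ n k
convSum-cong f≗f′ g≗g′ n zero    = cong₂ _*_ (f≗f′ 0) (g≗g′ n)
convSum-cong f≗f′ g≗g′ n (suc k) =
  cong₂ _+_ (cong₂ _*_ (f≗f′ (suc k)) (g≗g′ (n ∸ suc k))) (convSum-cong f≗f′ g≗g′ n k)

⊗-cong : ∀ {f f′ g g′} → f ≗ f′ → g ≗ g′ → f ⊗ g ≗ f′ ⊗ g′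
⊗-cong f≗f′ g≗g′ n = convSum-cong f≗f′ g≗g′ n n

convSum-suc : ∀ f g n k → convSum f g (suc n) (suc k) ≡ f 0 * g (suc n) + convSum (tail f) g n k
convSum-suc f g n zero    = +-comm (f 1 * g n) (f 0 * g (suc n))
convSum-suc f g n (suc k) = begin
  f (suc (suc k)) * g (n ∸ suc k) + convSum f g (suc n) (suc k)
    ≡⟨ cong (f (suc (suc k)) * g (n ∸ suc k) +_) (convSum-suc f g n k) ⟩
  f (suc (suc k)) * g (n ∸ suc k) + (f 0 * g (suc n) + convSum (tail f) g n k)
    ≡⟨ ℤ+.x∙yz≈y∙xz (f (suc (suc k)) * g (n ∸ suc k)) (f 0 * g (suc n)) _ ⟩
  f 0 * g (suc n) + (f (suc (suc k)) * g (n ∸ suc k) + convSum (tail f) g n k) ∎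
  where open ≡-Reasoning

⊗-suc : ∀ f g n → (f ⊗ g) (suc n) ≡ f 0 * g (suc n) + (tail f ⊗ g) n
⊗-suc f g n = convSum-suc f g n n

⊗-zeroˡ : ∀ g → const 0ℤ ⊗ g ≗ const 0ℤ
⊗-zeroˡ g zero    = *-zeroˡ (g 0)
⊗-zeroˡ g (suc n) = trans (⊗-suc (const 0ℤ) g n) (cong₂ _+_ (*-zeroˡ (g (suc n))) (⊗-zeroˡ g n))

⊗-identityˡ : ∀ g → one ⊗ g ≗ g
⊗-identityˡ g zero    = *-identityˡ (g 0)
⊗-identityˡ g (suc n) = begin
  (one ⊗ g) (suc n)                   ≡⟨ ⊗-suc one g n ⟩
  1ℤ * g (suc n) + (const 0ℤ ⊗ g) n ≡⟨ cong₂ _+_ (*-identityˡ (g (suc n))) (⊗-zeroˡ g n) ⟩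
  g (suc n) + 0ℤ                      ≡⟨ +-identityʳ (g (suc n)) ⟩
  g (suc n)                           ∎
  where open ≡-Reasoning

⊗-linearˡ : ∀ a f f′ g → (a · f ⊕ f′) ⊗ g ≗ a · (f ⊗ g) ⊕ f′ ⊗ g
⊗-linearˡ a f f′ g zero    = distrib a (f 0) (f′ 0) (g 0)
  where
  distrib : ∀ a x y z → (a * x + y) * z ≡ a * (x * z) + y * z
  distrib = solve-∀
⊗-linearˡ a f f′ g (suc n) = begin
  ((a · f ⊕ f′) ⊗ g) (suc n)
    ≡⟨ ⊗-suc (a · f ⊕ f′) g n ⟩
  (a * f 0 + f′ 0) * g (suc n) + ((a · tail f ⊕ tail f′) ⊗ g) n
    ≡⟨ cong ((a * f 0 + f′ 0) * g (suc n) +_) (⊗-linearˡ a (tail f) (tail f′) g n) ⟩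
  (a * f 0 + f′ 0) * g (suc n) + (a * (tail f ⊗ g) n + (tail f′ ⊗ g) n)
    ≡⟨ distrib a (f 0) (f′ 0) (g (suc n)) _ _ ⟩
  a * (f 0 * g (suc n) + (tail f ⊗ g) n) + (f′ 0 * g (suc n) + (tail f′ ⊗ g) n)
    ≡⟨ sym (cong₂ (λ u v → a * u + v) (⊗-suc f g n) (⊗-suc f′ g n)) ⟩
  a * (f ⊗ g) (suc n) + (f′ ⊗ g) (suc n) ∎
  where
  open ≡-Reasoning
  distrib : ∀ a x y z u v → (a * x + y) * z + (a * u + v) ≡ a * (x * z + u) + (y * z + v)
  distrib = solve-∀

⊗-distribʳ-⊖ : ∀ f f′ g → (f ⊖ f′) ⊗ g ≗ f ⊗ g ⊖ f′ ⊗ g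
⊗-distribʳ-⊖ f f′ g zero    = distrib (f 0) (f′ 0) (g 0)
  where
  distrib : ∀ x y z → (x - y) * z ≡ x * z - y * z
  distrib = solve-∀
⊗-distribʳ-⊖ f f′ g (suc n) = begin
  ((f ⊖ f′) ⊗ g) (suc n)
    ≡⟨ ⊗-suc (f ⊖ f′) g n ⟩
  (f 0 - f′ 0) * g (suc n) + ((tail f ⊖ tail f′) ⊗ g) n
    ≡⟨ cong ((f 0 - f′ 0) * g (suc n) +_) (⊗-distribʳ-⊖ (tail f) (tail f′) g n) ⟩
  (f 0 - f′ 0) * g (suc n) + ((tail f ⊗ g) n - (tail f′ ⊗ g) n)
    ≡⟨ distrib (f 0) (f′ 0) (g (suc n)) _ _ ⟩
  (f 0 * g (suc n) + (tail f ⊗ g) n) - (f′ 0 * g (suc n) + (tail f′ ⊗ g) n)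
    ≡⟨ sym (cong₂ _-_ (⊗-suc f g n) (⊗-suc f′ g n)) ⟩
  (f ⊗ g) (suc n) - (f′ ⊗ g) (suc n) ∎
  where
  open ≡-Reasoning
  distrib : ∀ x y z u v → (x - y) * z + (u - v) ≡ (x * z + u) - (y * z + v)
  distrib = solve-∀

⊗-comm : ∀ f g → f ⊗ g ≗ g ⊗ f
⊗-comm f g zero          = *-comm (f 0) (g 0)
⊗-comm f g (suc zero)    = swap (f 0) (g 1) (f 1) (g 0)
  where
  swap : ∀ a b c d → c * d + a * b ≡ b * a + d * c
  swap = solve-∀
⊗-comm f g (suc (suc n)) = begin
  (f ⊗ g) (2 +ℕ n)
    ≡⟨ ⊗-suc f g (suc n) ⟩
  f 0 * g (2 +ℕ n) + (tail f ⊗ g) (suc n)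
    ≡⟨ cong (f 0 * g (2 +ℕ n) +_) (trans (⊗-comm (tail f) g (suc n)) (⊗-suc g (tail f) n)) ⟩
  f 0 * g (2 +ℕ n) + (g 0 * f (2 +ℕ n) + (tail g ⊗ tail f) n)
    ≡⟨ cong (λ x → f 0 * g (2 +ℕ n) + (g 0 * f (2 +ℕ n) + x)) (⊗-comm (tail g) (tail f) n) ⟩
  f 0 * g (2 +ℕ n) + (g 0 * f (2 +ℕ n) + (tail f ⊗ tail g) n)
    ≡⟨ ℤ+.x∙yz≈y∙xz (f 0 * g (2 +ℕ n)) (g 0 * f (2 +ℕ n)) _ ⟩
  g 0 * f (2 +ℕ n) + (f 0 * g (2 +ℕ n) + (tail f ⊗ tail g) n)
    ≡⟨ sym (cong (g 0 * f (2 +ℕ n) +_) (trans (⊗-comm (tail g) f (suc n)) (⊗-suc f (tail g) n))) ⟩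
  g 0 * f (2 +ℕ n) + (tail g ⊗ f) (suc n)
    ≡⟨ sym (⊗-suc g f (suc n)) ⟩
  (g ⊗ f) (2 +ℕ n) ∎
  where open ≡-Reasoning

⊗-assoc : ∀ f g h → (f ⊗ g) ⊗ h ≗ f ⊗ (g ⊗ h)
⊗-assoc f g h zero    = *-assoc (f 0) (g 0) (h 0)
⊗-assoc f g h (suc n) = begin
  ((f ⊗ g) ⊗ h) (suc n)
    ≡⟨ ⊗-suc (f ⊗ g) h n ⟩
  f 0 * g 0 * h (suc n) + (tail (f ⊗ g) ⊗ h) n
    ≡⟨ cong (f 0 * g 0 * h (suc n) +_) (⊗-cong (⊗-suc f g) (λ _ → refl) n) ⟩
  f 0 * g 0 * h (suc n) + ((f 0 · tail g ⊕ tail f ⊗ g) ⊗ h) n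
    ≡⟨ cong (f 0 * g 0 * h (suc n) +_) (⊗-linearˡ (f 0) (tail g) (tail f ⊗ g) h n) ⟩
  f 0 * g 0 * h (suc n) + (f 0 * (tail g ⊗ h) n + ((tail f ⊗ g) ⊗ h) n)
    ≡⟨ cong (λ x → f 0 * g 0 * h (suc n) + (f 0 * (tail g ⊗ h) n + x)) (⊗-assoc (tail f) g h n) ⟩
  f 0 * g 0 * h (suc n) + (f 0 * (tail g ⊗ h) n + (tail f ⊗ (g ⊗ h)) n)
    ≡⟨ distrib (f 0) (g 0) (h (suc n)) _ _ ⟩
  f 0 * (g 0 * h (suc n) + (tail g ⊗ h) n) + (tail f ⊗ (g ⊗ h)) n
    ≡⟨ cong (λ x → f 0 * x + (tail f ⊗ (g ⊗ h)) n) (sym (⊗-suc g h n)) ⟩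
  f 0 * (g ⊗ h) (suc n) + (tail f ⊗ (g ⊗ h)) n
    ≡⟨ sym (⊗-suc f (g ⊗ h) n) ⟩
  (f ⊗ (g ⊗ h)) (suc n) ∎
  where
  open ≡-Reasoning
  distrib : ∀ a b c x y → a * b * c + (a * x + y) ≡ a * (b * c + x) + y
  distrib = solve-∀

⊗-commutativeMonoid : CommutativeMonoid _ _
⊗-commutativeMonoid = record
  { Carrier             = Series
  ; _≈_                 = _≗_
  ; _∙_                 = _⊗_
  ; ε                   = one
  ; isCommutativeMonoid = record
    { isMonoid = record
      { isSemigroup = record
        { isMagma = record
          { isEquivalence = Setoid.isEquivalence (ℕ →-setoid ℤ)
          ; ∙-cong        = ⊗-cong
          }
        ; assoc       = ⊗-assoc
        }
      ; identity    = ⊗-identityˡ , λ f n → trans (⊗-comm f one n) (⊗-identityˡ f n)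
      }
    ; comm     = ⊗-comm
    }
  }

module ⊗ = CommutativeMonoid ⊗-commutativeMonoid
open CommutativeSemigroupProperties ⊗.commutativeSemigroup using (interchange; x∙yz≈y∙xz)

coeffsDown : Series → ℕ → List ℤ
coeffsDown g zero    = g 0 ∷ []
coeffsDown g (suc n) = g (suc n) ∷ coeffsDown g n

invRev≡coeffsDown : ∀ f n → invRev f n ≡ coeffsDown (inv f) n
invRev≡coeffsDown f zero    = refl
invRev≡coeffsDown f (suc n) = cong (inv f (suc n) ∷_) (invRev≡coeffsDown f n)

invStep-suc : ∀ f i gs → invStep f (suc i) gs ≡ invStep (tail f) i gs
invStep-suc f i []       = refl
invStep-suc f i (g ∷ gs) = cong (f (suc (suc i)) * g +_) (invStep-suc f (suc i) gs)

invStep-coeffsDown : ∀ f g n → invStep f 0 (coeffsDown g n) ≡ (tail f ⊗ g) n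
invStep-coeffsDown f g zero    = +-identityʳ (f 1 * g 0)
invStep-coeffsDown f g (suc n) = begin
  f 1 * g (suc n) + invStep f 1 (coeffsDown g n)      ≡⟨ cong (f 1 * g (suc n) +_) (invStep-suc f 0 (coeffsDown g n)) ⟩
  f 1 * g (suc n) + invStep (tail f) 0 (coeffsDown g n) ≡⟨ cong (f 1 * g (suc n) +_) (invStep-coeffsDown (tail f) g n) ⟩
  f 1 * g (suc n) + (tail (tail f) ⊗ g) n              ≡⟨ sym (⊗-suc (tail f) g n) ⟩
  (tail f ⊗ g) (suc n)                                 ∎
  where open ≡-Reasoning

inv-inverseʳ : ∀ f → f 0 ≡ 1ℤ → f ⊗ inv f ≗ one
inv-inverseʳ f f₀≡1 zero    = cong (_* 1ℤ) f₀≡1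
inv-inverseʳ f f₀≡1 (suc n) = begin
  (f ⊗ inv f) (suc n)                                ≡⟨ ⊗-suc f (inv f) n ⟩
  f 0 * - invStep f 0 (invRev f n) + (tail f ⊗ inv f) n
    ≡⟨ cong (λ x → f 0 * - x + (tail f ⊗ inv f) n)
            (trans (cong (invStep f 0) (invRev≡coeffsDown f n)) (invStep-coeffsDown f (inv f) n)) ⟩
  f 0 * - (tail f ⊗ inv f) n + (tail f ⊗ inv f) n      ≡⟨ cong (λ c → c * - (tail f ⊗ inv f) n + (tail f ⊗ inv f) n) f₀≡1 ⟩
  1ℤ * - (tail f ⊗ inv f) n + (tail f ⊗ inv f) n       ≡⟨ cancel ((tail f ⊗ inv f) n) ⟩
  0ℤ                                                  ∎
  where
  open ≡-Reasoning
  cancel : ∀ x → 1ℤ * - x + x ≡ 0ℤ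
  cancel = solve-∀

inv-unique : ∀ f u → f 0 ≡ 1ℤ → f ⊗ u ≗ one → u ≗ inv f
inv-unique f u f₀≡1 fu≗1 = begin
  u                   ≈⟨ ⊗.sym (⊗.identityʳ u) ⟩
  u ⊗ one             ≈⟨ ⊗.∙-congˡ (⊗.sym (inv-inverseʳ f f₀≡1)) ⟩
  u ⊗ (f ⊗ inv f)     ≈⟨ ⊗.sym (⊗.assoc u f (inv f)) ⟩
  (u ⊗ f) ⊗ inv f     ≈⟨ ⊗.∙-congʳ (⊗.trans (⊗.comm u f) fu≗1) ⟩
  one ⊗ inv f         ≈⟨ ⊗.identityˡ (inv f) ⟩
  inv f               ∎
  where open SetoidReasoning ⊗.setoid

inv-one : inv one ≗ one
inv-one = ⊗.sym (inv-unique one one refl (⊗.identityˡ one))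

inv-⊗ : ∀ f g → f 0 ≡ 1ℤ → g 0 ≡ 1ℤ → inv (f ⊗ g) ≗ inv f ⊗ inv g
inv-⊗ f g f₀≡1 g₀≡1 = ⊗.sym (inv-unique (f ⊗ g) (inv f ⊗ inv g) (cong₂ _*_ f₀≡1 g₀≡1) (begin
  (f ⊗ g) ⊗ (inv f ⊗ inv g)    ≈⟨ interchange f g (inv f) (inv g) ⟩
  (f ⊗ inv f) ⊗ (g ⊗ inv g)    ≈⟨ ⊗.∙-cong (inv-inverseʳ f f₀≡1) (inv-inverseʳ g g₀≡1) ⟩
  one ⊗ one                    ≈⟨ ⊗.identityˡ one ⟩
  one                          ∎))
  where open SetoidReasoning ⊗.setoid

mono-diag : ∀ a → mono a a ≡ 1ℤ
mono-diag a with a ≟ a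
... | yes _   = refl
... | no  a≢a = contradiction refl a≢a

mono-off : ∀ a m → m ≢ a → mono a m ≡ 0ℤ
mono-off a m m≢a with m ≟ a
... | yes m≡a = contradiction m≡a m≢a
... | no  _   = refl

mono-zero : mono 0 ≗ one
mono-zero zero    = refl
mono-zero (suc _) = refl

mono-suc : ∀ a m → mono (suc a) (suc m) ≡ mono a m
mono-suc a m with m ≟ a
... | yes refl = mono-diag (suc m)
... | no  m≢a  = mono-off (suc a) (suc m) (m≢a ∘ ℕ.suc-injective)

shift : ℕ → Series → Series
shift zero    g         = g
shift (suc a) g zero    = 0ℤ
shift (suc a) g (suc n) = shift a g n

shift-cong : ∀ a {g g′} → g ≗ g′ → shift a g ≗ shift a g′
shift-cong zero    g≗g′ n       = g≗g′ n
shift-cong (suc a) g≗g′ zero    = refl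
shift-cong (suc a) g≗g′ (suc n) = shift-cong a g≗g′ n

shift-+ : ∀ a g t → shift a g (a +ℕ t) ≡ g t
shift-+ zero    g t = refl
shift-+ (suc a) g t = shift-+ a g t

mono-⊗ : ∀ a g → mono a ⊗ g ≗ shift a g
mono-⊗ zero    g n       = trans (⊗-cong mono-zero (λ _ → refl) n) (⊗-identityˡ g n)
mono-⊗ (suc a) g zero    = *-zeroˡ (g 0)
mono-⊗ (suc a) g (suc n) = begin
  (mono (suc a) ⊗ g) (suc n)                       ≡⟨ ⊗-suc (mono (suc a)) g n ⟩
  0ℤ * g (suc n) + (tail (mono (suc a)) ⊗ g) n      ≡⟨ cong₂ _+_ (*-zeroˡ (g (suc n))) (⊗-cong (mono-suc a) (λ _ → refl) n) ⟩
  0ℤ + (mono a ⊗ g) n                              ≡⟨ +-identityˡ _ ⟩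
  (mono a ⊗ g) n                                   ≡⟨ mono-⊗ a g n ⟩
  shift a g n                                      ∎
  where open ≡-Reasoning

oneMinusMono : ℕ → Series
oneMinusMono a = one ⊖ mono a

geometric : ℕ → Series
geometric a = inv (oneMinusMono a)

geometric-inverseʳ : ∀ a → oneMinusMono (suc a) ⊗ geometric (suc a) ≗ one
geometric-inverseʳ a = inv-inverseʳ (oneMinusMono (suc a)) refl

geometricProduct : ℕ → ℕ → Series
geometricProduct s zero    = one
geometricProduct s (suc n) = geometricProduct s n ⊗ geometric (s +ℕ n)

qPoch-constant : ∀ s n → qPoch (suc s) n 0 ≡ 1ℤ
qPoch-constant s zero    = refl
qPoch-constant s (suc n) = cong (_* 1ℤ) (qPoch-constant s n)

inv-qPoch : ∀ s n → inv (qPoch (suc s) n) ≗ geometricProduct (suc s) n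
inv-qPoch s zero    = inv-one
inv-qPoch s (suc n) = ⊗.trans
  (inv-⊗ (qPoch (suc s) n) (oneMinusMono (suc s +ℕ n)) (qPoch-constant s n) refl)
  (⊗.∙-congʳ (inv-qPoch s n))

⊗-geometric-unfold : ∀ a y → y ⊗ geometric (suc a) ≗ y ⊕ shift (suc a) (y ⊗ geometric (suc a))
⊗-geometric-unfold a y n = begin
  z n                                       ≡⟨ split (z n) (shift (suc a) z n) ⟩
  z n - shift (suc a) z n + shift (suc a) z n
    ≡⟨ cong (_+ shift (suc a) z n) (sym (cong₂ _-_ (⊗-identityˡ z n) (mono-⊗ (suc a) z n))) ⟩
  (one ⊗ z) n - (mono (suc a) ⊗ z) n + shift (suc a) z n
    ≡⟨ cong (_+ shift (suc a) z n) (sym (⊗-distribʳ-⊖ one (mono (suc a)) z n)) ⟩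
  (oneMinusMono (suc a) ⊗ z) n + shift (suc a) z n
    ≡⟨ cong (_+ shift (suc a) z n) (cancel n) ⟩
  y n + shift (suc a) z n                   ∎
  where
  open ≡-Reasoning
  z = y ⊗ geometric (suc a)
  split : ∀ x s → x ≡ x - s + s
  split = solve-∀
  cancel : oneMinusMono (suc a) ⊗ z ≗ y
  cancel = ⊗.trans (x∙yz≈y∙xz (oneMinusMono (suc a)) y (geometric (suc a)))
                   (⊗.trans (⊗.∙-congˡ (geometric-inverseʳ a)) (⊗.identityʳ y))

partialStrideSum : ℕ → Series → ℕ → Series
partialStrideSum a y zero    = const 0ℤ
partialStrideSum a y (suc k) = y ⊕ shift a (partialStrideSum a y k)

-- Only the first n + 1 terms of the stride sum reach index n.
strideSum : ℕ → Series → Series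
strideSum a y n = partialStrideSum a y (suc n) n

shift-cong-below : ∀ a {g g′} n → (∀ m → m +ℕ a ≤ n → g m ≡ g′ m) → shift a g n ≡ shift a g′ n
shift-cong-below zero    n       g≗g′ = g≗g′ n (ℕ.≤-reflexive (ℕ.+-identityʳ n))
shift-cong-below (suc a) zero    g≗g′ = refl
shift-cong-below (suc a) (suc n) g≗g′ =
  shift-cong-below a n (λ m m+a≤n → g≗g′ m (subst (_≤ suc n) (sym (ℕ.+-suc m a)) (s≤s m+a≤n)))

strideSum-unique : ∀ d y z → z ≗ y ⊕ shift (suc d) z → z ≗ strideSum (suc d) y
strideSum-unique d y z z-rec n = agree (suc n) n ℕ.≤-refl
  where
  agree : ∀ k n → n < k → z n ≡ partialStrideSum (suc d) y k n
  agree (suc k) n (s≤s n≤k) = trans (z-rec n) (cong (y n +_) (shift-cong-below (suc d) n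
    (λ m m+1+d≤n → agree k m (ℕ.<-≤-trans (ℕ.m<m+n m z<s) (ℕ.≤-trans m+1+d≤n n≤k)))))

⊗-geometric≗strideSum : ∀ d {y y′} → y ≗ y′ → y ⊗ geometric (suc d) ≗ strideSum (suc d) y′
⊗-geometric≗strideSum d {y} {y′} y≗y′ = strideSum-unique d y′ (y ⊗ geometric (suc d))
  (λ n → trans (⊗-geometric-unfold d y n) (cong (_+ _) (y≗y′ n)))

strideSum-step : ∀ d y t → strideSum (suc d) y (suc d +ℕ t) ≡ y (suc d +ℕ t) + strideSum (suc d) y t
strideSum-step d y t = begin
  strideSum (suc d) y (suc d +ℕ t)            ≡⟨ sym (z≗s (suc d +ℕ t)) ⟩
  z (suc d +ℕ t)                              ≡⟨ ⊗-geometric-unfold d y (suc d +ℕ t) ⟩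
  y (suc d +ℕ t) + shift (suc d) z (suc d +ℕ t) ≡⟨ cong (y (suc d +ℕ t) +_) (trans (shift-+ (suc d) z t) (z≗s t)) ⟩
  y (suc d +ℕ t) + strideSum (suc d) y t      ∎
  where
  open ≡-Reasoning
  z = y ⊗ geometric (suc d)
  z≗s : z ≗ strideSum (suc d) y
  z≗s = ⊗-geometric≗strideSum d (λ _ → refl)

strideWindow : ℕ → Series → ℕ → ℕ → ℤ
strideWindow a y zero    t = 0ℤ
strideWindow a y (suc k) t = y (suc k *ℕ a +ℕ t) + strideWindow a y k t

strideSum-window : ∀ d y k t →
  strideSum (suc d) y (k *ℕ suc d +ℕ t) ≡ strideWindow (suc d) y k t + strideSum (suc d) y t
strideSum-window d y zero    t = sym (+-identityˡ _)
strideSum-window d y (suc k) t = begin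
  strideSum (suc d) y (suc k *ℕ suc d +ℕ t)
    ≡⟨ cong (strideSum (suc d) y) (ℕ.+-assoc (suc d) (k *ℕ suc d) t) ⟩
  strideSum (suc d) y (suc d +ℕ (k *ℕ suc d +ℕ t))
    ≡⟨ strideSum-step d y (k *ℕ suc d +ℕ t) ⟩
  y (suc d +ℕ (k *ℕ suc d +ℕ t)) + strideSum (suc d) y (k *ℕ suc d +ℕ t)
    ≡⟨ cong₂ _+_ (cong y (sym (ℕ.+-assoc (suc d) (k *ℕ suc d) t))) (strideSum-window d y k t) ⟩
  y (suc k *ℕ suc d +ℕ t) + (strideWindow (suc d) y k t + strideSum (suc d) y t)
    ≡⟨ sym (+-assoc (y (suc k *ℕ suc d +ℕ t)) (strideWindow (suc d) y k t) (strideSum (suc d) y t)) ⟩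
  strideWindow (suc d) y (suc k) t + strideSum (suc d) y t ∎
  where open ≡-Reasoning

strideWindow-periodic : ∀ d y p → (∀ n → y (p +ℕ suc n) ≡ y (suc n)) →
  ∀ k t → strideWindow (suc d) y k (p +ℕ t) ≡ strideWindow (suc d) y k t
strideWindow-periodic d y p y-periodic zero    t = refl
strideWindow-periodic d y p y-periodic (suc k) t = cong₂ _+_
  (trans (cong y (ℕ+.x∙yz≈y∙xz (suc k *ℕ suc d) p t)) (y-periodic (d +ℕ k *ℕ suc d +ℕ t)))
  (strideWindow-periodic d y p y-periodic k t)

nonneg-on-window? : ∀ (f : ℕ → ℤ) b p → Dec (∀ (i : Fin (suc p)) → 0ℤ ≤ℤ f (b +ℕ toℕ i))
nonneg-on-window? f b p = all? λ i → 0ℤ ℤ.≤? f (b +ℕ toℕ i)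

nonneg-from-window : ∀ (f : ℕ → ℤ) b p →
  (∀ t → b ≤ t → f t ≤ℤ f (suc p +ℕ t)) →
  (∀ (i : Fin (suc p)) → 0ℤ ≤ℤ f (b +ℕ toℕ i)) →
  ∀ n → b ≤ n → 0ℤ ≤ℤ f n
nonneg-from-window f b p f-increases window = <-rec _ step
  where
  step : ∀ n → WfRec _<_ (λ m → b ≤ m → 0ℤ ≤ℤ f m) n → b ≤ n → 0ℤ ≤ℤ f n
  step n rec b≤n with n ∸ b <? suc p
  ... | yes n∸b<1+p = subst (λ m → 0ℤ ≤ℤ f m)
          (trans (cong (b +ℕ_) (toℕ-fromℕ< n∸b<1+p)) (ℕ.m+[n∸m]≡n b≤n))
          (window (fromℕ< n∸b<1+p))
  ... | no  n∸b≮1+p = ℤ.≤-trans (rec t<n b≤t) (subst (λ m → f t ≤ℤ f m) 1+p+t≡n (f-increases t b≤t))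
    where
    t = n ∸ suc p
    1+p+b≤n : suc p +ℕ b ≤ n
    1+p+b≤n = ℕ.m≤o∸n⇒m+n≤o (suc p) b≤n (ℕ.≮⇒≥ n∸b≮1+p)
    1+p+t≡n : suc p +ℕ t ≡ n
    1+p+t≡n = ℕ.m+[n∸m]≡n (ℕ.≤-trans (ℕ.m≤m+n (suc p) b) 1+p+b≤n)
    b≤t : b ≤ t
    b≤t = ℕ.m+n≤o⇒m≤o∸n b (subst (_≤ n) (ℕ.+-comm (suc p) b) 1+p+b≤n)
    t<n : t < n
    t<n = subst (t <_) 1+p+t≡n (ℕ.m<n+m t z<s)

≤-+ˡ : ∀ {x} y → 0ℤ ≤ℤ x → y ≤ℤ x + y
≤-+ˡ {x} y 0≤x = subst (_≤ℤ x + y) (+-identityˡ y) (ℤ.+-monoˡ-≤ y 0≤x)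

strideSum-nonneg-from-window : ∀ d y b →
  (∀ t → b ≤ t → 0ℤ ≤ℤ y (suc d +ℕ t)) →
  (∀ (i : Fin (suc d)) → 0ℤ ≤ℤ strideSum (suc d) y (b +ℕ toℕ i)) →
  ∀ n → b ≤ n → 0ℤ ≤ℤ strideSum (suc d) y n
strideSum-nonneg-from-window d y b y-nonneg = nonneg-from-window (strideSum (suc d) y) b d
  (λ t b≤t → subst (strideSum (suc d) y t ≤ℤ_) (sym (strideSum-step d y t)) (≤-+ˡ _ (y-nonneg t b≤t)))

geometricProduct-suc : ∀ s n → geometricProduct s (suc n) ≗ geometric s ⊗ geometricProduct (suc s) n
geometricProduct-suc s zero = begin
  one ⊗ geometric (s +ℕ 0)   ≈⟨ ⊗.identityˡ _ ⟩
  geometric (s +ℕ 0)         ≡⟨ cong geometric (ℕ.+-identityʳ s) ⟩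
  geometric s                ≈⟨ ⊗.sym (⊗.identityʳ _) ⟩
  geometric s ⊗ one          ∎
  where open SetoidReasoning ⊗.setoid
geometricProduct-suc s (suc n) = begin
  geometricProduct s (suc n) ⊗ geometric (s +ℕ suc n)
    ≈⟨ ⊗.∙-congʳ (geometricProduct-suc s n) ⟩
  (geometric s ⊗ geometricProduct (suc s) n) ⊗ geometric (s +ℕ suc n)
    ≈⟨ ⊗.assoc _ _ _ ⟩
  geometric s ⊗ (geometricProduct (suc s) n ⊗ geometric (s +ℕ suc n))
    ≡⟨ cong (λ a → geometric s ⊗ (geometricProduct (suc s) n ⊗ geometric a)) (ℕ.+-suc s n) ⟩
  geometric s ⊗ geometricProduct (suc s) (suc n) ∎
  where open SetoidReasoning ⊗.setoid

iteratedStrideSum : ℕ → ℕ → Series → Series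
iteratedStrideSum s zero    y = y
iteratedStrideSum s (suc n) y = strideSum (s +ℕ n) (iteratedStrideSum s n y)

⊗-geometricProduct≗iteratedStrideSum : ∀ s n {y y′} → y ≗ y′ →
  y ⊗ geometricProduct (suc s) n ≗ iteratedStrideSum (suc s) n y′
⊗-geometricProduct≗iteratedStrideSum s zero    y≗y′ = ⊗.trans (⊗.identityʳ _) y≗y′
⊗-geometricProduct≗iteratedStrideSum s (suc n) {y} y≗y′ = ⊗.trans
  (⊗.sym (⊗.assoc y (geometricProduct (suc s) n) (geometric (suc s +ℕ n))))
  (⊗-geometric≗strideSum (s +ℕ n) (⊗-geometricProduct≗iteratedStrideSum s n y≗y′))

geometric≗strideSum : ∀ d → geometric (suc d) ≗ strideSum (suc d) one
geometric≗strideSum d = ⊗.trans (⊗.sym (⊗.identityˡ _)) (⊗-geometric≗strideSum d (λ _ → refl))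

strideSum-one-periodic : ∀ d k t → strideSum (suc d) one (k *ℕ suc d +ℕ t) ≡ strideSum (suc d) one t
strideSum-one-periodic d zero    t = refl
strideSum-one-periodic d (suc k) t = begin
  strideSum (suc d) one (suc k *ℕ suc d +ℕ t)     ≡⟨ cong (strideSum (suc d) one) (ℕ.+-assoc (suc d) (k *ℕ suc d) t) ⟩
  strideSum (suc d) one (suc d +ℕ (k *ℕ suc d +ℕ t)) ≡⟨ strideSum-step d one (k *ℕ suc d +ℕ t) ⟩
  0ℤ + strideSum (suc d) one (k *ℕ suc d +ℕ t)      ≡⟨ +-identityˡ _ ⟩
  strideSum (suc d) one (k *ℕ suc d +ℕ t)           ≡⟨ strideSum-one-periodic d k t ⟩
  strideSum (suc d) one t                          ∎
  where open ≡-Reasoning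

H-first-term : mono 3 ⊗ oneMinusMono 4 ⊗ inv (qPoch 3 5) ≗ mono 3 ⊗ geometric 3 ⊗ geometricProduct 5 3
H-first-term = begin
  mono 3 ⊗ B₄ ⊗ inv (qPoch 3 5)                ≈⟨ ⊗.∙-congˡ (inv-qPoch 2 5) ⟩
  mono 3 ⊗ B₄ ⊗ geometricProduct 3 5           ≈⟨ ⊗.∙-congˡ (geometricProduct-suc 3 4) ⟩
  mono 3 ⊗ B₄ ⊗ (g₃ ⊗ geometricProduct 4 4)    ≈⟨ ⊗.∙-congˡ (⊗.∙-congˡ (geometricProduct-suc 4 3)) ⟩
  mono 3 ⊗ B₄ ⊗ (g₃ ⊗ (g₄ ⊗ P))                ≈⟨ interchange (mono 3) B₄ g₃ (g₄ ⊗ P) ⟩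
  mono 3 ⊗ g₃ ⊗ (B₄ ⊗ (g₄ ⊗ P))                ≈⟨ ⊗.∙-congˡ (⊗.sym (⊗.assoc B₄ g₄ P)) ⟩
  mono 3 ⊗ g₃ ⊗ (B₄ ⊗ g₄ ⊗ P)                  ≈⟨ ⊗.∙-congˡ (⊗.∙-congʳ (geometric-inverseʳ 3)) ⟩
  mono 3 ⊗ g₃ ⊗ (one ⊗ P)                      ≈⟨ ⊗.∙-congˡ (⊗.identityˡ P) ⟩
  mono 3 ⊗ g₃ ⊗ P                              ∎
  where
  open SetoidReasoning ⊗.setoid
  B₄ = oneMinusMono 4
  g₃ = geometric 3
  g₄ = geometric 4
  P  = geometricProduct 5 3

F : Series
F = mono 3 ⊗ geometric 3 ⊖ geometric 4

H-decomposition : H 4 3 4 ≗ F ⊗ geometricProduct 5 3 ⊕ one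
H-decomposition n = begin
  H 4 3 4 n                                    ≡⟨ cong₂ (λ u v → u - (v - one n)) (H-first-term n) (second-term≗ n) ⟩
  (mono 3 ⊗ g₃ ⊗ P) n - ((g₄ ⊗ P) n - one n)     ≡⟨ reassoc ((mono 3 ⊗ g₃ ⊗ P) n) ((g₄ ⊗ P) n) (one n) ⟩
  (mono 3 ⊗ g₃ ⊗ P) n - (g₄ ⊗ P) n + one n       ≡⟨ cong (_+ one n) (sym (⊗-distribʳ-⊖ (mono 3 ⊗ g₃) g₄ P n)) ⟩
  (F ⊗ P) n + one n                             ∎
  where
  open ≡-Reasoning
  g₃ = geometric 3
  g₄ = geometric 4
  P  = geometricProduct 5 3
  reassoc : ∀ x y z → x - (y - z) ≡ x - y + z
  reassoc = solve-∀
  second-term≗ : inv (qPoch 4 4) ≗ g₄ ⊗ P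
  second-term≗ = ⊗.trans (inv-qPoch 3 4) (geometricProduct-suc 4 3)

f : Series
f = shift 3 (strideSum 3 one) ⊖ strideSum 4 one

F≗f : F ≗ f
F≗f n = cong₂ _-_ (trans (mono-⊗ 3 (geometric 3) n) (shift-cong 3 (geometric≗strideSum 2) n))
                  (geometric≗strideSum 3 n)

f₅ f₅₆ f₅₆₇ : Series
f₅   = strideSum 5 f
f₅₆  = strideSum 6 f₅
f₅₆₇ = strideSum 7 f₅₆

H≗f₅₆₇+1 : H 4 3 4 ≗ f₅₆₇ ⊕ one
H≗f₅₆₇+1 n = trans (H-decomposition n) (cong (_+ one n) (⊗-geometricProduct≗iteratedStrideSum 4 3 F≗f n))

-- Not at index 0: f 0 = -1 but f 12 = 0.
f-periodic : ∀ n → f (12 +ℕ suc n) ≡ f (suc n)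
f-periodic zero          = refl
f-periodic (suc zero)    = refl
f-periodic (suc (suc j)) = cong₂ _-_ (strideSum-one-periodic 2 4 j) (strideSum-one-periodic 3 3 (3 +ℕ j))

f₅-increment-nonneg : ∀ t → 0ℤ ≤ℤ strideWindow 5 f 12 t
f₅-increment-nonneg t = nonneg-from-window (strideWindow 5 f 12) 0 11
  (λ s _ → ℤ.≤-reflexive (sym (strideWindow-periodic 4 f 12 f-periodic 12 s)))
  (from-yes (nonneg-on-window? (strideWindow 5 f 12) 0 11)) t z≤n

f₅-nonneg : ∀ n → 41 ≤ n → 0ℤ ≤ℤ f₅ n
f₅-nonneg = nonneg-from-window f₅ 41 59
  (λ t _ → subst (f₅ t ≤ℤ_) (sym (strideSum-window 4 f 12 t)) (≤-+ˡ _ (f₅-increment-nonneg t)))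
  (from-yes (nonneg-on-window? f₅ 41 59))

f₅₆-nonneg : ∀ n → 71 ≤ n → 0ℤ ≤ℤ f₅₆ n
f₅₆-nonneg = strideSum-nonneg-from-window 5 f₅ 71
  (λ t 71≤t → f₅-nonneg (6 +ℕ t) (ℕ.m≤n⇒m≤o+n 6 (ℕ.≤-trans (ℕ.m≤m+n 41 30) 71≤t)))
  (from-yes (nonneg-on-window? f₅₆ 71 5))

f₅₆₇-nonneg : ∀ n → 64 ≤ n → 0ℤ ≤ℤ f₅₆₇ n
f₅₆₇-nonneg = strideSum-nonneg-from-window 6 f₅₆ 64
  (λ t 64≤t → f₅₆-nonneg (7 +ℕ t) (ℕ.+-monoʳ-≤ 7 64≤t))
  (from-yes (nonneg-on-window? f₅₆₇ 64 6))

lemma19 : (N : ℕ) → 1042 ≤ N → 0ℤ ≤ℤ H 4 3 4 N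
lemma19 (suc N) 1042≤1+N = subst (0ℤ ≤ℤ_) (sym (trans (H≗f₅₆₇+1 (suc N)) (+-identityʳ _)))
  (f₅₆₇-nonneg (suc N) (ℕ.≤-trans (ℕ.m≤m+n 64 978) 1042≤1+N))
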